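{- For a graph $G=(V,E)$ and a minimal maximal Roman dominating function $f:V\to\{0,1,2\}$ on $G$, we have $\emptyset\neq V\setminus N[V_0(f)]\subseteq V_1(f)$.
   Context: Graphs are finite, simple and undirected. $N(v)$ is the open neighborhood, $N[v]=N(v)\cup\{v\}$, $N[A]=\bigcup_{v\in A}N[v]$. For $f:V\to\{0,1,2\}$, $V_i(f)=\{v: f(v)=i\}$; $f\le g$ is pointwise. A maximal Roman dominating function (mRdf) on $G$ is an $f:V\to\{0,1,2\}$ such that $N(v)\cap V_2(f)\ne\emptyset$ for every $v\in V_0(f)$ and $N[V_0(f)]\ne V$. It is minimal if no mRdf $g\le f$ with $g\ne f$ exists. -}

module Defs where

open import Data.Nat using (ℕ)
open import Data.Fin using (Fin)
open import Data.Bool using (Bool; true; false)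
open import Data.Product using (Σ; _×_; ∃)
open import Relation.Binary.PropositionalEquality using (_≡_; _≢_)
open import Relation.Nullary using (¬_)

record Graph (n : ℕ) : Set where
  field
    adj   : Fin n → Fin n → Bool
    sym   : ∀ u v → adj u v ≡ adj v u
    irrefl : ∀ v → adj v v ≡ false

open Graph public

_∈N[_]_ : ∀ {n} → Fin n → Graph n → Fin n → Set
u ∈N[ G ] v = adj G v u ≡ true

data Label : Set where
  l0 l1 l2 : Label

data _≤L_ : Label → Label → Set where
  0≤ : ∀ {x} → l0 ≤L x
  1≤1 : l1 ≤L l1
  1≤2 : l1 ≤L l2
  2≤2 : l2 ≤L l2

RFun : ℕ → Set
RFun n = Fin n → Label

_≤F_ : ∀ {n} → RFun n → RFun n → Set
f ≤F g = ∀ v → f v ≤L g v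

InClosedNbhdV0 : ∀ {n} → Graph n → RFun n → Fin n → Set
InClosedNbhdV0 G f v = (f v ≡ l0) ⊎' (Σ _ λ u → (u ∈N[ G ] v) × (f u ≡ l0))
  where
    open import Data.Sum renaming (_⊎_ to _⊎'_)

record IsMRDF {n} (G : Graph n) (f : RFun n) : Set where
  field
    dominating : ∀ v → f v ≡ l0 → Σ (Fin n) λ u → (u ∈N[ G ] v) × (f u ≡ l2)
    notAll     : ¬ (∀ v → InClosedNbhdV0 G f v)

record IsMinimalMRDF {n} (G : Graph n) (f : RFun n) : Set where
  field
    isMRDF  : IsMRDF G f
    minimal : ¬ (Σ (RFun n) λ g → IsMRDF G g × (g ≤F f) × ¬ (∀ v → g v ≡ f v))

-- A vertex v outside N[V₀(f)] cannot have label 0, since v ∈ N[v].  If it had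
-- label 2, lowering it to 1 would give a smaller mRdf: V₀ is unchanged, no vertex
-- of V₀ is adjacent to v and so none relies on v for domination, and v is still
-- outside N[V₀].  Minimality therefore forces label 1.
module Submission where

open import Defs
open import Data.Empty using (⊥-elim)
open import Data.Nat using (ℕ)
open import Data.Fin using (Fin; _≟_)
open import Data.Product using (_×_; _,_; Σ)
open import Data.Sum using (inj₁; inj₂)
open import Data.Vec.Functional using (updateAt)
open import Data.Vec.Functional.Properties using (updateAt-updates; updateAt-minimal)
open import Function using (const)
open import Relation.Binary.PropositionalEquality as ≡ using (_≡_; _≢_; refl; trans)
open import Relation.Nullary using (¬_; yes; no)

private
  variable
    n : ℕ

≤L-refl : ∀ {x} → x ≤L x
≤L-refl {l0} = 0≤
≤L-refl {l1} = 1≤1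
≤L-refl {l2} = 2≤2

∈N-sym : (G : Graph n) {u v : Fin n} → u ∈N[ G ] v → v ∈N[ G ] u
∈N-sym G {u} {v} u∈Nv = trans (sym G u v) u∈Nv

InClosedNbhdV0-mono : (G : Graph n) {f g : RFun n} →
  (∀ w → g w ≡ l0 → f w ≡ l0) →
  ∀ {v} → InClosedNbhdV0 G g v → InClosedNbhdV0 G f v
InClosedNbhdV0-mono G g⊆f (inj₁ gv≡0)            = inj₁ (g⊆f _ gv≡0)
InClosedNbhdV0-mono G g⊆f (inj₂ (u , u∈Nv , gu≡0)) = inj₂ (u , u∈Nv , g⊆f u gu≡0)

relabel : RFun n → Fin n → Label → RFun n
relabel f v x = updateAt f v (const x)

relabel-at : (f : RFun n) (v : Fin n) (x : Label) → relabel f v x v ≡ x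
relabel-at f v x = updateAt-updates v f

relabel-elsewhere : (f : RFun n) {v w : Fin n} (x : Label) → w ≢ v → relabel f v x w ≡ f w
relabel-elsewhere f {v} {w} x w≢v = updateAt-minimal w v f w≢v

relabel-≤F : (f : RFun n) {v : Fin n} {x : Label} → x ≤L f v → relabel f v x ≤F f
relabel-≤F f {v} {x} x≤fv w with w ≟ v
... | yes refl = ≡.subst (_≤L f w) (≡.sym (relabel-at f w x)) x≤fv
... | no w≢v   = ≡.subst (_≤L f w) (≡.sym (relabel-elsewhere f x w≢v)) ≤L-refl

relabel-zero : (f : RFun n) {v : Fin n} {x : Label} → x ≢ l0 →
  ∀ w → relabel f v x w ≡ l0 → f w ≡ l0
relabel-zero f {v} {x} x≢0 w gw≡0 with w ≟ v
... | yes refl = ⊥-elim (x≢0 (trans (≡.sym (relabel-at f w x)) gw≡0))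
... | no w≢v   = trans (≡.sym (relabel-elsewhere f x w≢v)) gw≡0

≢l0-≢l2⇒≡l1 : ∀ {x} → x ≢ l0 → x ≢ l2 → x ≡ l1
≢l0-≢l2⇒≡l1 {l0} x≢0 _   = ⊥-elim (x≢0 refl)
≢l0-≢l2⇒≡l1 {l1} _   _   = refl
≢l0-≢l2⇒≡l1 {l2} _   x≢2 = ⊥-elim (x≢2 refl)

relabel-IsMRDF : (G : Graph n) {f : RFun n} {v : Fin n} {x : Label} → x ≢ l0 →
  IsMRDF G f → ¬ InClosedNbhdV0 G f v → IsMRDF G (relabel f v x)
relabel-IsMRDF G {f} {v} {x} x≢0 f-mrdf v∉ = record
  { dominating = dominating
  ; notAll     = λ all → v∉ (InClosedNbhdV0-mono G zeros⊆ (all v))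
  }
  where
  zeros⊆ : ∀ w → relabel f v x w ≡ l0 → f w ≡ l0
  zeros⊆ = relabel-zero f x≢0

  dominating : ∀ w → relabel f v x w ≡ l0 →
    Σ _ λ u → (u ∈N[ G ] w) × (relabel f v x u ≡ l2)
  dominating w gw≡0 with IsMRDF.dominating f-mrdf w (zeros⊆ w gw≡0)
  ... | u , u∈Nw , fu≡2 with u ≟ v
  ...   | yes refl = ⊥-elim (v∉ (inj₂ (w , ∈N-sym G u∈Nw , zeros⊆ w gw≡0)))
  ...   | no u≢v   = u , u∈Nw , trans (relabel-elsewhere f x u≢v) fu≡2

minimal-outside⇒≢l2 : (G : Graph n) {f : RFun n} → IsMinimalMRDF G f →
  ∀ {v} → ¬ InClosedNbhdV0 G f v → f v ≢ l2
minimal-outside⇒≢l2 G {f} f-min {v} v∉ fv≡2 = IsMinimalMRDF.minimal f-min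
  ( relabel f v l1
  , relabel-IsMRDF G (λ ()) (IsMinimalMRDF.isMRDF f-min) v∉
  , relabel-≤F f (≡.subst (l1 ≤L_) (≡.sym fv≡2) 1≤2)
  , λ g≗f → l1≢l2 (trans (≡.sym (relabel-at f v l1)) (trans (g≗f v) fv≡2))
  )
  where
  l1≢l2 : l1 ≢ l2
  l1≢l2 ()

corollary2 : ∀ {n} (G : Graph n) (f : RFun n) → IsMinimalMRDF G f →
    ¬ (∀ v → InClosedNbhdV0 G f v)
      × (∀ v → ¬ InClosedNbhdV0 G f v → f v ≡ l1)
corollary2 G f f-min =
    IsMRDF.notAll (IsMinimalMRDF.isMRDF f-min)
  , λ v v∉ → ≢l0-≢l2⇒≡l1 (λ fv≡0 → v∉ (inj₁ fv≡0)) (minimal-outside⇒≢l2 G f-min v∉)
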